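{- If a graph $G$ has a unique minimum edge-vertex dominating set, then $G$ has a unique minimum paired-dominating set.
   Context: All graphs are finite and simple. A set $D\subseteq V_G$ is dominating if every vertex outside $D$ has a neighbour in $D$; it is a paired-dominating set if it is dominating and the induced subgraph $G[D]$ has a perfect matching; minimum means of minimum cardinality. An edge $e$ ev-dominates a vertex $v$ if $e$ is incident to $v$ or $e$ is incident to a vertex adjacent to $v$. A set $M\subseteq E_G$ is an edge-vertex dominating set if every vertex of $G$ is ev-dominated by some edge of $M$; minimum means of minimum cardinality. -}

module Defs where

open import Data.Nat using (ℕ; _≤_)
open import Data.Fin using (Fin)
open import Data.Fin.Subset using (Subset; _∈_; ∣_∣)
open import Data.Product using (Σ; _×_; _,_; ∃; ∃-syntax; proj₁; proj₂)
open import Data.Sum using (_⊎_)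
open import Relation.Binary.PropositionalEquality using (_≡_; _≢_)
open import Relation.Nullary using (¬_)

record Graph (n m : ℕ) : Set where
  field
    src tgt  : Fin m → Fin n
    no-loop  : ∀ e → src e ≢ tgt e
    no-multi : ∀ e f →
      ((src e ≡ src f × tgt e ≡ tgt f) ⊎ (src e ≡ tgt f × tgt e ≡ src f)) → e ≡ f

module _ {n m : ℕ} (G : Graph n m) where
  open Graph G

  Incident : Fin m → Fin n → Set
  Incident e v = src e ≡ v ⊎ tgt e ≡ v

  Adj : Fin n → Fin n → Set
  Adj u v = ∃[ e ] ((src e ≡ u × tgt e ≡ v) ⊎ (src e ≡ v × tgt e ≡ u))

  Dominating : Subset n → Set
  Dominating D = ∀ v → v ∈ D ⊎ (∃[ u ] (u ∈ D × Adj u v))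

  PerfectMatchingOf : Subset n → Subset m → Set
  PerfectMatchingOf D M =
    (∀ e → e ∈ M → src e ∈ D × tgt e ∈ D) ×
    (∀ v → v ∈ D → ∃[ e ] (e ∈ M × Incident e v)) ×
    (∀ v e f → e ∈ M → f ∈ M → Incident e v → Incident f v → e ≡ f)

  PairedDominating : Subset n → Set
  PairedDominating D = Dominating D × ∃[ M ] PerfectMatchingOf D M

  EvDominates : Fin m → Fin n → Set
  EvDominates e v = Incident e v ⊎ (∃[ u ] (Incident e u × Adj u v))

  EdgeVertexDominating : Subset m → Set
  EdgeVertexDominating M = ∀ v → ∃[ e ] (e ∈ M × EvDominates e v)

IsMinimum : {k : ℕ} → (Subset k → Set) → Subset k → Set
IsMinimum P S = P S × (∀ T → P T → ∣ S ∣ ≤ ∣ T ∣)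

HasUniqueMinimum : {k : ℕ} → (Subset k → Set) → Set
HasUniqueMinimum P = ∃[ S ] (IsMinimum P S × (∀ T → IsMinimum P T → T ≡ S))

-- A minimum edge-vertex dominating set M that is unique must be a matching: if two of its
-- edges e, f met at v, with f = vw, then f could be exchanged for an edge g ≠ f that
-- ev-dominates the closed neighbourhood of w (an edge at w missing v, or else e itself, since
-- then v is the only neighbour of w), giving a second minimum edge-vertex dominating set.
-- So the set V(M) of endpoints of M is paired-dominating with |V(M)| = 2|M|. Conversely, the
-- perfect matching N of a paired-dominating set D is edge-vertex dominating with D = V(N)
-- and |D| = 2|N|. Hence |V(M)| = 2|M| ≤ 2|N| = |D|, and equality forces N = M, so D = V(M).
module Submission where

open import Defs
open import Data.Nat using (ℕ; suc; _+_; _*_; _≤_)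
open import Data.Nat.Properties
  using (+-suc; +-comm; +-identityʳ; m≤m+n; ≤-trans; ≤-reflexive; +-mono-≤; *-monoˡ-≤; *-cancelʳ-≤; module ≤-Reasoning)
open import Data.Fin using (Fin; zero; suc; _≟_)
open import Data.Fin.Properties using (any?; 0≢1+n; suc-injective)
open import Data.Fin.Subset using (Subset; inside; outside; _∈_; _∉_; ∣_∣; ⊥; ⁅_⁆; _∪_; _∩_; _─_; _-_; Nonempty; Empty)
open import Data.Fin.Subset.Properties
  using (x∈p∪q⁺; x∈p∪q⁻; x∈p∩q⁺; x∈p∩q⁻; x∈⁅x⁆; x∈⁅y⁆⇒x≡y; ∣⁅x⁆∣≡1; ∉⊥; ∣⊥∣≡0; Empty-unique; ⊆-antisym; x∈p∧x≢y⇒x∈p-y; x∈p⇒∣p-x∣<∣p∣)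
open import Data.Vec.Base using ([]; _∷_; here; there)
open import Data.Product using (_×_; _,_; ∃-syntax; proj₁; proj₂)
open import Data.Sum using (_⊎_; inj₁; inj₂; [_,_]′)
open import Data.Empty using (⊥-elim)
open import Relation.Nullary using (¬_; Dec; yes; no; ¬?; contradiction)
open import Relation.Nullary.Decidable using (_×-dec_; _⊎-dec_)
open import Relation.Binary.PropositionalEquality using (_≡_; _≢_; refl; sym; trans; cong; cong₂; subst; module ≡-Reasoning)

private variable
  k n : ℕ
  x y : Fin n

∣p∪q∣+∣p∩q∣≡∣p∣+∣q∣ : (p q : Subset n) → ∣ p ∪ q ∣ + ∣ p ∩ q ∣ ≡ ∣ p ∣ + ∣ q ∣
∣p∪q∣+∣p∩q∣≡∣p∣+∣q∣ []            []            = refl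
∣p∪q∣+∣p∩q∣≡∣p∣+∣q∣ (inside ∷ p)  (inside ∷ q)  =
  cong suc (trans (+-suc _ _) (trans (cong suc (∣p∪q∣+∣p∩q∣≡∣p∣+∣q∣ p q)) (sym (+-suc _ _))))
∣p∪q∣+∣p∩q∣≡∣p∣+∣q∣ (inside ∷ p)  (outside ∷ q) = cong suc (∣p∪q∣+∣p∩q∣≡∣p∣+∣q∣ p q)
∣p∪q∣+∣p∩q∣≡∣p∣+∣q∣ (outside ∷ p) (inside ∷ q)  =
  trans (cong suc (∣p∪q∣+∣p∩q∣≡∣p∣+∣q∣ p q)) (sym (+-suc _ _))
∣p∪q∣+∣p∩q∣≡∣p∣+∣q∣ (outside ∷ p) (outside ∷ q) = ∣p∪q∣+∣p∩q∣≡∣p∣+∣q∣ p q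

∣p∪q∣≤∣p∣+∣q∣ : (p q : Subset n) → ∣ p ∪ q ∣ ≤ ∣ p ∣ + ∣ q ∣
∣p∪q∣≤∣p∣+∣q∣ p q = subst (∣ p ∪ q ∣ ≤_) (∣p∪q∣+∣p∩q∣≡∣p∣+∣q∣ p q) (m≤m+n _ _)

∣p∪q∣≡∣p∣+∣q∣ : (p q : Subset n) → Empty (p ∩ q) → ∣ p ∪ q ∣ ≡ ∣ p ∣ + ∣ q ∣
∣p∪q∣≡∣p∣+∣q∣ {n} p q disjoint = begin
  ∣ p ∪ q ∣                ≡⟨ sym (+-identityʳ _) ⟩
  ∣ p ∪ q ∣ + 0            ≡⟨ cong (∣ p ∪ q ∣ +_) ∣p∩q∣≡0 ⟨
  ∣ p ∪ q ∣ + ∣ p ∩ q ∣    ≡⟨ ∣p∪q∣+∣p∩q∣≡∣p∣+∣q∣ p q ⟩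
  ∣ p ∣ + ∣ q ∣            ∎
  where
  open ≡-Reasoning
  ∣p∩q∣≡0 : ∣ p ∩ q ∣ ≡ 0
  ∣p∩q∣≡0 = trans (cong ∣_∣ (Empty-unique disjoint)) (∣⊥∣≡0 n)

∣⁅x⁆∪⁅y⁆∣≡2 : x ≢ y → ∣ ⁅ x ⁆ ∪ ⁅ y ⁆ ∣ ≡ 2
∣⁅x⁆∪⁅y⁆∣≡2 {x = x} {y} x≢y = begin
  ∣ ⁅ x ⁆ ∪ ⁅ y ⁆ ∣        ≡⟨ ∣p∪q∣≡∣p∣+∣q∣ ⁅ x ⁆ ⁅ y ⁆ disjoint ⟩
  ∣ ⁅ x ⁆ ∣ + ∣ ⁅ y ⁆ ∣    ≡⟨ cong₂ _+_ (∣⁅x⁆∣≡1 x) (∣⁅x⁆∣≡1 y) ⟩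
  2                        ∎
  where
  open ≡-Reasoning
  disjoint : Empty (⁅ x ⁆ ∩ ⁅ y ⁆)
  disjoint (z , z∈∩) with x∈p∩q⁻ ⁅ x ⁆ ⁅ y ⁆ z∈∩
  ... | z∈⁅x⁆ , z∈⁅y⁆ = x≢y (trans (sym (x∈⁅y⁆⇒x≡y x z∈⁅x⁆)) (x∈⁅y⁆⇒x≡y y z∈⁅y⁆))

x∈p─q⇒x∉q : (p q : Subset n) → x ∈ p ─ q → x ∉ q
x∈p─q⇒x∉q (s ∷ p) (t ∷ q) (there x∈p─q) (there x∈q) = x∈p─q⇒x∉q p q x∈p─q x∈q

∣p-x∪⁅y⁆∣≤∣p∣ : {p : Subset n} {x y : Fin n} → x ∈ p → ∣ (p - x) ∪ ⁅ y ⁆ ∣ ≤ ∣ p ∣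
∣p-x∪⁅y⁆∣≤∣p∣ {p = p} {x} {y} x∈p = begin
  ∣ (p - x) ∪ ⁅ y ⁆ ∣      ≤⟨ ∣p∪q∣≤∣p∣+∣q∣ (p - x) ⁅ y ⁆ ⟩
  ∣ p - x ∣ + ∣ ⁅ y ⁆ ∣    ≡⟨ cong (∣ p - x ∣ +_) (∣⁅x⁆∣≡1 y) ⟩
  ∣ p - x ∣ + 1            ≡⟨ +-comm _ 1 ⟩
  suc ∣ p - x ∣            ≤⟨ x∈p⇒∣p-x∣<∣p∣ x∈p ⟩
  ∣ p ∣                    ∎
  where open ≤-Reasoning

⋃ᵢ : Subset k → (Fin k → Subset n) → Subset n
⋃ᵢ []            F = ⊥
⋃ᵢ (inside ∷ p)  F = F zero ∪ ⋃ᵢ p (λ i → F (suc i))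
⋃ᵢ (outside ∷ p) F = ⋃ᵢ p (λ i → F (suc i))

x∈⋃ᵢ⁺ : ∀ (p : Subset k) (F : Fin k → Subset n) {i} → i ∈ p → x ∈ F i → x ∈ ⋃ᵢ p F
x∈⋃ᵢ⁺ (inside ∷ p)  F here        x∈Fi = x∈p∪q⁺ (inj₁ x∈Fi)
x∈⋃ᵢ⁺ (inside ∷ p)  F (there i∈p) x∈Fi = x∈p∪q⁺ (inj₂ (x∈⋃ᵢ⁺ p _ i∈p x∈Fi))
x∈⋃ᵢ⁺ (outside ∷ p) F (there i∈p) x∈Fi = x∈⋃ᵢ⁺ p _ i∈p x∈Fi

x∈⋃ᵢ⁻ : ∀ (p : Subset k) (F : Fin k → Subset n) → x ∈ ⋃ᵢ p F → ∃[ i ] (i ∈ p × x ∈ F i)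
x∈⋃ᵢ⁻ [] F x∈⊥ = contradiction x∈⊥ ∉⊥
x∈⋃ᵢ⁻ (inside ∷ p) F x∈⋃ with x∈p∪q⁻ (F zero) _ x∈⋃
... | inj₁ x∈F0 = zero , here , x∈F0
... | inj₂ x∈⋃p with x∈⋃ᵢ⁻ p _ x∈⋃p
...   | i , i∈p , x∈Fi = suc i , there i∈p , x∈Fi
x∈⋃ᵢ⁻ (outside ∷ p) F x∈⋃ with x∈⋃ᵢ⁻ p _ x∈⋃
... | i , i∈p , x∈Fi = suc i , there i∈p , x∈Fi

∣⋃ᵢ∣≤ : ∀ (p : Subset k) (F : Fin k → Subset n) c → (∀ i → ∣ F i ∣ ≤ c) → ∣ ⋃ᵢ p F ∣ ≤ ∣ p ∣ * c
∣⋃ᵢ∣≤ {n = n} []            F c ∣F∣≤c = ≤-reflexive (∣⊥∣≡0 n)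
∣⋃ᵢ∣≤ (inside ∷ p)  F c ∣F∣≤c =
  ≤-trans (∣p∪q∣≤∣p∣+∣q∣ (F zero) _) (+-mono-≤ (∣F∣≤c zero) (∣⋃ᵢ∣≤ p _ c (λ i → ∣F∣≤c (suc i))))
∣⋃ᵢ∣≤ (outside ∷ p) F c ∣F∣≤c = ∣⋃ᵢ∣≤ p _ c (λ i → ∣F∣≤c (suc i))

∣⋃ᵢ∣≡ : ∀ (p : Subset k) (F : Fin k → Subset n) c →
  (∀ i → i ∈ p → ∣ F i ∣ ≡ c) →
  (∀ i j → i ∈ p → j ∈ p → Nonempty (F i ∩ F j) → i ≡ j) →
  ∣ ⋃ᵢ p F ∣ ≡ ∣ p ∣ * c
∣⋃ᵢ∣≡ {n = n} []            F c ∣F∣≡c meet⇒≡ = ∣⊥∣≡0 n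
∣⋃ᵢ∣≡ (inside ∷ p)  F c ∣F∣≡c meet⇒≡ =
  trans (∣p∪q∣≡∣p∣+∣q∣ (F zero) _ disjoint)
        (cong₂ _+_ (∣F∣≡c zero here) (∣⋃ᵢ∣≡ p _ c (λ i i∈p → ∣F∣≡c (suc i) (there i∈p))
                                              (λ i j i∈p j∈p o → suc-injective (meet⇒≡ _ _ (there i∈p) (there j∈p) o))))
  where
  disjoint : Empty (F zero ∩ ⋃ᵢ p (λ i → F (suc i)))
  disjoint (z , z∈∩) with x∈p∩q⁻ (F zero) _ z∈∩
  ... | z∈F0 , z∈⋃ with x∈⋃ᵢ⁻ p _ z∈⋃
  ...   | i , i∈p , z∈Fi = 0≢1+n (meet⇒≡ zero (suc i) here (there i∈p) (z , x∈p∩q⁺ (z∈F0 , z∈Fi)))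
∣⋃ᵢ∣≡ (outside ∷ p) F c ∣F∣≡c meet⇒≡ =
  ∣⋃ᵢ∣≡ p _ c (λ i i∈p → ∣F∣≡c (suc i) (there i∈p)) (λ i j i∈p j∈p o → suc-injective (meet⇒≡ _ _ (there i∈p) (there j∈p) o))

module _ {n m : ℕ} (G : Graph n m) where
  open Graph G

  Incident? : ∀ e v → Dec (Incident G e v)
  Incident? e v = (src e ≟ v) ⊎-dec (tgt e ≟ v)

  -- Adj G v w is definitionally ∃[ f ] Joins f v w.
  Joins : Fin m → Fin n → Fin n → Set
  Joins f v w = (src f ≡ v × tgt f ≡ w) ⊎ (src f ≡ w × tgt f ≡ v)

  Joins-sym : ∀ {f v w} → Joins f v w → Joins f w v
  Joins-sym (inj₁ vw) = inj₂ vw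
  Joins-sym (inj₂ wv) = inj₁ wv

  Joins⇒Incident : ∀ {f v w} → Joins f v w → Incident G f v
  Joins⇒Incident (inj₁ (src≡v , _)) = inj₁ src≡v
  Joins⇒Incident (inj₂ (_ , tgt≡v)) = inj₂ tgt≡v

  Joins⇒≢ : ∀ {f v w} → Joins f v w → v ≢ w
  Joins⇒≢ {f} (inj₁ (refl , refl)) = no-loop f
  Joins⇒≢ {f} (inj₂ (refl , refl)) v≡w = no-loop f (sym v≡w)

  Incident⇒Joins : ∀ {f v} → Incident G f v → ∃[ w ] Joins f v w
  Incident⇒Joins {f} (inj₁ src≡v) = tgt f , inj₁ (src≡v , refl)
  Incident⇒Joins {f} (inj₂ tgt≡v) = src f , inj₂ (refl , tgt≡v)

  Joins-Incident : ∀ {f v w z} → Joins f v w → Incident G f z → z ≡ v ⊎ z ≡ w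
  Joins-Incident (inj₁ (refl , _)) (inj₁ refl) = inj₁ refl
  Joins-Incident (inj₁ (_ , refl)) (inj₂ refl) = inj₂ refl
  Joins-Incident (inj₂ (refl , _)) (inj₁ refl) = inj₂ refl
  Joins-Incident (inj₂ (_ , refl)) (inj₂ refl) = inj₁ refl

  ends : Fin m → Subset n
  ends e = ⁅ src e ⁆ ∪ ⁅ tgt e ⁆

  ∈ends⁺ : ∀ {e v} → Incident G e v → v ∈ ends e
  ∈ends⁺ (inj₁ refl) = x∈p∪q⁺ (inj₁ (x∈⁅x⁆ _))
  ∈ends⁺ (inj₂ refl) = x∈p∪q⁺ (inj₂ (x∈⁅x⁆ _))

  ∈ends⁻ : ∀ {e v} → v ∈ ends e → Incident G e v
  ∈ends⁻ {e} v∈ends with x∈p∪q⁻ ⁅ src e ⁆ ⁅ tgt e ⁆ v∈ends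
  ... | inj₁ v∈⁅src⁆ = inj₁ (sym (x∈⁅y⁆⇒x≡y _ v∈⁅src⁆))
  ... | inj₂ v∈⁅tgt⁆ = inj₂ (sym (x∈⁅y⁆⇒x≡y _ v∈⁅tgt⁆))

  ∣ends∣≡2 : ∀ e → ∣ ends e ∣ ≡ 2
  ∣ends∣≡2 e = ∣⁅x⁆∪⁅y⁆∣≡2 (no-loop e)

  endpoints : Subset m → Subset n
  endpoints M = ⋃ᵢ M ends

  ∈endpoints⁺ : ∀ {M e v} → e ∈ M → Incident G e v → v ∈ endpoints M
  ∈endpoints⁺ {M} e∈M ev = x∈⋃ᵢ⁺ M ends e∈M (∈ends⁺ ev)

  ∈endpoints⁻ : ∀ {M v} → v ∈ endpoints M → ∃[ e ] (e ∈ M × Incident G e v)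
  ∈endpoints⁻ {M} v∈ with x∈⋃ᵢ⁻ M ends v∈
  ... | e , e∈M , v∈ends = e , e∈M , ∈ends⁻ v∈ends

  ∣endpoints∣≤∣M∣*2 : ∀ M → ∣ endpoints M ∣ ≤ ∣ M ∣ * 2
  ∣endpoints∣≤∣M∣*2 M = ∣⋃ᵢ∣≤ M ends 2 (λ e → ≤-reflexive (∣ends∣≡2 e))

  IsMatching : Subset m → Set
  IsMatching M = ∀ v e f → e ∈ M → f ∈ M → Incident G e v → Incident G f v → e ≡ f

  ∣endpoints∣≡∣M∣*2 : ∀ {M} → IsMatching M → ∣ endpoints M ∣ ≡ ∣ M ∣ * 2
  ∣endpoints∣≡∣M∣*2 {M} matching = ∣⋃ᵢ∣≡ M ends 2 (λ e _ → ∣ends∣≡2 e) ends-meet⇒≡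
    where
    ends-meet⇒≡ : ∀ e f → e ∈ M → f ∈ M → Nonempty (ends e ∩ ends f) → e ≡ f
    ends-meet⇒≡ e f e∈M f∈M (v , v∈∩) with x∈p∩q⁻ (ends e) (ends f) v∈∩
    ... | v∈e , v∈f = matching v e f e∈M f∈M (∈ends⁻ v∈e) (∈ends⁻ v∈f)

  matching⇒perfectMatchingOf-endpoints : ∀ {M} → IsMatching M → PerfectMatchingOf G (endpoints M) M
  matching⇒perfectMatchingOf-endpoints matching =
    (λ e e∈M → ∈endpoints⁺ e∈M (inj₁ refl) , ∈endpoints⁺ e∈M (inj₂ refl)) ,
    (λ v v∈ → ∈endpoints⁻ v∈) ,
    matching

  perfectMatchingOf⇒≡endpoints : ∀ {D N} → PerfectMatchingOf G D N → D ≡ endpoints N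
  perfectMatchingOf⇒≡endpoints {D} {N} (N⊆G[D] , covers , _) = ⊆-antisym D⊆ ⊆D
    where
    D⊆ : ∀ {v} → v ∈ D → v ∈ endpoints N
    D⊆ {v} v∈D with covers v v∈D
    ... | e , e∈N , ev = ∈endpoints⁺ e∈N ev
    ⊆D : ∀ {v} → v ∈ endpoints N → v ∈ D
    ⊆D v∈ with ∈endpoints⁻ v∈
    ... | e , e∈N , inj₁ refl = proj₁ (N⊆G[D] e e∈N)
    ... | e , e∈N , inj₂ refl = proj₂ (N⊆G[D] e e∈N)

  ∣D∣≡∣N∣*2 : ∀ {D N} → PerfectMatchingOf G D N → ∣ D ∣ ≡ ∣ N ∣ * 2
  ∣D∣≡∣N∣*2 pm@(_ , _ , matching) =
    trans (cong ∣_∣ (perfectMatchingOf⇒≡endpoints pm)) (∣endpoints∣≡∣M∣*2 matching)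

  evd⇒dominating-endpoints : ∀ {M} → EdgeVertexDominating G M → Dominating G (endpoints M)
  evd⇒dominating-endpoints evd z with evd z
  ... | e , e∈M , inj₁ ez              = inj₁ (∈endpoints⁺ e∈M ez)
  ... | e , e∈M , inj₂ (u , eu , u~z) = inj₂ (u , ∈endpoints⁺ e∈M eu , u~z)

  perfectMatchingOf⇒evd : ∀ {D N} → Dominating G D → PerfectMatchingOf G D N → EdgeVertexDominating G N
  perfectMatchingOf⇒evd dom (_ , covers , _) z with dom z
  ... | inj₁ z∈D with covers z z∈D
  ...   | e , e∈N , ez = e , e∈N , inj₁ ez
  perfectMatchingOf⇒evd dom (_ , covers , _) z | inj₂ (u , u∈D , u~z) with covers u u∈D
  ...   | e , e∈N , eu = e , e∈N , inj₂ (u , eu , u~z)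

  EvDominatesNbhd : Fin m → Fin n → Set
  EvDominatesNbhd g w = ∀ z → z ≡ w ⊎ Adj G w z → EvDominates G g z

  Incident⇒EvDominatesNbhd : ∀ {g w} → Incident G g w → EvDominatesNbhd g w
  Incident⇒EvDominatesNbhd gw _ (inj₁ refl) = inj₁ gw
  Incident⇒EvDominatesNbhd gw _ (inj₂ w~z)  = inj₂ (_ , gw , w~z)

  -- If every edge at w passes through v, then v is the only neighbour of w.
  pendant-EvDominatesNbhd : ∀ {e f v w} → Joins f v w → Incident G e v →
    (∀ h → Incident G h w → Incident G h v) → EvDominatesNbhd e w
  pendant-EvDominatesNbhd {f = f} {v} vw ev through-v _ (inj₁ refl) = inj₂ (v , ev , f , vw)
  pendant-EvDominatesNbhd vw ev through-v z (inj₂ (h , wz))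
    with Joins-Incident wz (through-v h (Joins⇒Incident wz))
  ... | inj₁ v≡w = ⊥-elim (Joins⇒≢ vw v≡w)
  ... | inj₂ refl = inj₁ ev

  EvDominatesNbhd-substitute : ∀ {e f v w} → Joins f v w → Incident G e v → e ≢ f →
    ∃[ g ] (g ≢ f × EvDominatesNbhd g w)
  EvDominatesNbhd-substitute {e} {f} {v} {w} vw ev e≢f
    with any? (λ g → Incident? g w ×-dec ¬? (Incident? g v))
  ... | yes (g , gw , ¬gv) = g , (λ { refl → ¬gv (Joins⇒Incident vw) }) , Incident⇒EvDominatesNbhd gw
  ... | no ∄g = e , e≢f , pendant-EvDominatesNbhd vw ev through-v
    where
    through-v : ∀ h → Incident G h w → Incident G h v
    through-v h hw with Incident? h v
    ... | yes hv = hv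
    ... | no ¬hv = ⊥-elim (∄g (h , hw , ¬hv))

  EvDominates-exchange : ∀ {e f g v w z} → Joins f v w → Incident G e v → EvDominatesNbhd g w →
    EvDominates G f z → EvDominates G e z ⊎ EvDominates G g z
  EvDominates-exchange vw ev g-nbhd (inj₁ fz) with Joins-Incident vw fz
  ... | inj₁ refl = inj₁ (inj₁ ev)
  ... | inj₂ refl = inj₂ (g-nbhd _ (inj₁ refl))
  EvDominates-exchange vw ev g-nbhd (inj₂ (u , fu , u~z)) with Joins-Incident vw fu
  ... | inj₁ refl = inj₁ (inj₂ (u , ev , u~z))
  ... | inj₂ refl = inj₂ (g-nbhd _ (inj₂ u~z))

  evd-exchange : ∀ {M e f g v w} → EdgeVertexDominating G M → e ∈ M → e ≢ f →
    Incident G e v → Joins f v w → EvDominatesNbhd g w →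
    EdgeVertexDominating G ((M - f) ∪ ⁅ g ⁆)
  evd-exchange {f = f} {g} evd e∈M e≢f ev vw g-nbhd z with evd z
  ... | h , h∈M , hz with h ≟ f
  ...   | no h≢f = h , x∈p∪q⁺ (inj₁ (x∈p∧x≢y⇒x∈p-y h∈M h≢f)) , hz
  ...   | yes refl with EvDominates-exchange vw ev g-nbhd hz
  ...     | inj₁ ez = _ , x∈p∪q⁺ (inj₁ (x∈p∧x≢y⇒x∈p-y e∈M e≢f)) , ez
  ...     | inj₂ gz = g , x∈p∪q⁺ (inj₂ (x∈⁅x⁆ g)) , gz

  module _ {M : Subset m} (M-minimum : IsMinimum (EdgeVertexDominating G) M)
           (M-unique : ∀ T → IsMinimum (EdgeVertexDominating G) T → T ≡ M) where

    -- The exchanged set is no larger than M, hence minimum, hence M itself; but f was removed.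
    ¬evd-exchange : ∀ {f g} → f ∈ M → g ≢ f → ¬ EdgeVertexDominating G ((M - f) ∪ ⁅ g ⁆)
    ¬evd-exchange {f} {g} f∈M g≢f evd′ =
      [ (λ f∈M-f → x∈p─q⇒x∉q M ⁅ f ⁆ f∈M-f (x∈⁅x⁆ f)) , (λ f∈⁅g⁆ → g≢f (sym (x∈⁅y⁆⇒x≡y g f∈⁅g⁆))) ]′
        (x∈p∪q⁻ (M - f) ⁅ g ⁆ (subst (f ∈_) (sym M′≡M) f∈M))
      where
      M′≡M : (M - f) ∪ ⁅ g ⁆ ≡ M
      M′≡M = M-unique _ (evd′ , λ T evd → ≤-trans (∣p-x∪⁅y⁆∣≤∣p∣ f∈M) (proj₂ M-minimum T evd))

    uniqueMinimumEvd⇒matching : IsMatching M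
    uniqueMinimumEvd⇒matching v e f e∈M f∈M ev fv with e ≟ f | Incident⇒Joins fv
    ... | yes e≡f | _ = e≡f
    ... | no e≢f | w , vw with EvDominatesNbhd-substitute vw ev e≢f
    ...   | g , g≢f , g-nbhd =
      ⊥-elim (¬evd-exchange f∈M g≢f (evd-exchange (proj₁ M-minimum) e∈M e≢f ev vw g-nbhd))

corollary4 : {n m : ℕ} (G : Graph n m) →
    HasUniqueMinimum (EdgeVertexDominating G) →
    HasUniqueMinimum (PairedDominating G)
corollary4 G (M , M-minimum@(evd , M-min) , M-unique) = endpoints G M , (pd , minimal) , unique
  where
  open ≤-Reasoning
  matching : IsMatching G M
  matching = uniqueMinimumEvd⇒matching G M-minimum M-unique
  pd : PairedDominating G (endpoints G M)
  pd = evd⇒dominating-endpoints G evd , M , matching⇒perfectMatchingOf-endpoints G matching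
  minimal : ∀ T → PairedDominating G T → ∣ endpoints G M ∣ ≤ ∣ T ∣
  minimal T (dom , N , pm) = begin
    ∣ endpoints G M ∣  ≤⟨ ∣endpoints∣≤∣M∣*2 G M ⟩
    ∣ M ∣ * 2          ≤⟨ *-monoˡ-≤ 2 (M-min N (perfectMatchingOf⇒evd G dom pm)) ⟩
    ∣ N ∣ * 2          ≡⟨ ∣D∣≡∣N∣*2 G pm ⟨
    ∣ T ∣              ∎
  unique : ∀ T → IsMinimum (PairedDominating G) T → T ≡ endpoints G M
  unique T ((dom , N , pm) , T-min) =
    trans (perfectMatchingOf⇒≡endpoints G pm) (cong (endpoints G) N≡M)
    where
    ∣N∣≤∣M∣ : ∣ N ∣ ≤ ∣ M ∣
    ∣N∣≤∣M∣ = *-cancelʳ-≤ _ _ 2 (begin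
      ∣ N ∣ * 2          ≡⟨ ∣D∣≡∣N∣*2 G pm ⟨
      ∣ T ∣              ≤⟨ T-min _ pd ⟩
      ∣ endpoints G M ∣  ≤⟨ ∣endpoints∣≤∣M∣*2 G M ⟩
      ∣ M ∣ * 2          ∎)
    N≡M : N ≡ M
    N≡M = M-unique N (perfectMatchingOf⇒evd G dom pm , λ S evd → ≤-trans ∣N∣≤∣M∣ (M-min S evd))
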